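{- Let $G=G[X_1,X_2]$ be a simple bipartite graph with parts $X_1,X_2$ on $n\ge 5$ vertices such that $|X_1|>|X_2|$ and every vertex of $X_2$ has degree at least $\tfrac12(n+1)$. Then any two vertices $x_1\in X_1$ and $x_2\in X_2$ with $d(x_1),d(x_2)\ge 2$ are joined by a path which visits every vertex of $X_2$. -}

module Defs where

open import Data.Nat using (ℕ; suc; _+_; _*_; _≤_; _<_)
open import Data.Bool using (Bool; true; false; T; _≟_)
open import Data.Fin using (Fin)
open import Data.List using (List; []; _∷_; filter; length; head; last)
open import Data.List.Relation.Unary.All using (All)
open import Data.List.Relation.Unary.Unique.Propositional using (Unique)
open import Data.List.Membership.Propositional using (_∈_)
open import Data.List.Relation.Unary.Linked using (Linked)
open import Data.Maybe using (Maybe; just)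
open import Data.Product using (_×_)
open import Data.List.Base using (allFin)
open import Relation.Binary.PropositionalEquality using (_≡_)
open import Data.Bool.Properties using (T?)
open import Data.Empty using (⊥)

record SimpleGraph (n : ℕ) : Set where
  field
    adj       : Fin n → Fin n → Bool
    symmetric : ∀ u v → adj u v ≡ adj v u
    loopless  : ∀ v → adj v v ≡ false
open SimpleGraph public

Adj : ∀ {n} → SimpleGraph n → Fin n → Fin n → Set
Adj G u v = T (adj G u v)

degree : ∀ {n} → SimpleGraph n → Fin n → ℕ
degree {n} G v = length (filter (λ u → T? (adj G v u)) (allFin n))

-- A bipartition into parts X₁ = {v | part v ≡ true}, X₂ = {v | part v ≡ false}
-- such that every edge joins X₁ and X₂.
IsBipartition : ∀ {n} → SimpleGraph n → (Fin n → Bool) → Set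
IsBipartition G part = ∀ u v → Adj G u v → part u ≡ part v → ⊥

partSize : ∀ {n} → (Fin n → Bool) → Bool → ℕ
partSize {n} part b = length (filter (λ v → part v ≟ b) (allFin n))

record Path {n} (G : SimpleGraph n) (x y : Fin n) : Set where
  field
    vertices : List (Fin n)
    distinct : Unique vertices
    walk     : Linked (Adj G) vertices
    starts   : head vertices ≡ just x
    ends     : last vertices ≡ just y
open Path public

-- Two vertices u, v of X₂ satisfy d(u) + d(v) ≥ n + 1 > |X₁| + |X₂|, and all their neighbours lie
-- in X₁, so they have more than |X₂| common neighbours. Hence a path ending in x₂ can always be
-- extended by a new vertex z of X₂: join z to the current first vertex through a common neighbour
-- not yet used. Such a path uses one vertex of X₁ fewer than of X₂, so together with x₁ it uses at
-- most |X₂| vertices of X₁ and a fresh common neighbour exists. Starting from x₂, absorb every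
-- vertex of X₂ except a neighbour y₁ ≠ x₂ of x₁ (it exists as d(x₁) ≥ 2), then prepend y₁ and x₁.
module Submission where

open import Defs
open import Data.Nat using (ℕ; suc; _+_; _*_; _≤_; _<_; z≤n; s≤s)
open import Data.Nat.Properties
  using (+-suc; +-comm; +-identityʳ; +-mono-≤; +-monoʳ-≤; *-distribˡ-+; *-cancelˡ-≤;
         +-cancelʳ-≤; <⇒≱; ≤-<-trans; module ≤-Reasoning)
open import Data.Bool using (Bool; true; false; not; T) renaming (_≟_ to _≟ᵇ_)
open import Data.Bool.Properties using (T?; ¬-not)
open import Data.Fin using (Fin) renaming (_≟_ to _≟ᶠ_)
open import Data.List using (List; []; _∷_; filter; length; allFin; last)
open import Data.List.Properties using (length-tabulate; length-filter; filter-none; filter-accept)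
open import Data.List.Relation.Unary.All as All using (All; []; _∷_; all?)
open import Data.List.Relation.Unary.All.Properties using (¬All⇒Any¬; ¬Any⇒All¬)
open import Data.List.Relation.Unary.Any using (here; there)
open import Data.List.Relation.Unary.AllPairs using ([]; _∷_)
open import Data.List.Relation.Unary.Unique.Propositional using (Unique)
import Data.List.Relation.Unary.Unique.Propositional.Properties as Unique
open import Data.List.Relation.Unary.Linked using (Linked; [-]; _∷_)
open import Data.List.Relation.Binary.Subset.Propositional using (_⊆_)
import Data.List.Relation.Binary.Sublist.Propositional as Sublist
import Data.List.Relation.Binary.Sublist.Propositional.Properties as Sublist
open import Data.List.Membership.Propositional using (_∈_; _∉_; find)
open import Data.List.Membership.Propositional.Properties using (∈-filter⁺; ∈-filter⁻; ∈-allFin)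
import Data.List.Membership.DecPropositional as DecMembership
open import Data.Maybe using (just)
open import Data.Product using (Σ; ∃-syntax; _×_; _,_; proj₂; uncurry)
open import Data.Sum as Sum using (_⊎_; inj₁; inj₂)
open import Function using (id; _∘_; case_of_)
open import Level using (Level)
open import Relation.Nullary using (¬_; yes; no; contradiction)
open import Relation.Unary using (Pred; Decidable)
open import Relation.Unary.Properties using (_∩?_; _∪?_)
open import Relation.Binary.Definitions using (DecidableEquality)
open import Relation.Binary.PropositionalEquality using (_≡_; _≢_; refl; sym; trans; cong; subst)

private
  variable
    a p : Level
    A : Set a

∈⇒∃-removal : ∀ {x : A} {ys} → x ∈ ys →
  ∃[ zs ] length ys ≡ suc (length zs) × (∀ {y} → y ∈ ys → x ≢ y → y ∈ zs)
∈⇒∃-removal {ys = _ ∷ ys} (here refl) = ys , refl , λ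
  { (here refl) x≢x → contradiction refl x≢x
  ; (there y∈ys) _  → y∈ys }
∈⇒∃-removal {ys = y ∷ _} (there x∈ys) with ∈⇒∃-removal x∈ys
... | zs , len , keep = y ∷ zs , cong suc len , λ
  { (here refl) _     → here refl
  ; (there y∈ys) x≢y  → there (keep y∈ys x≢y) }

unique-⊆⇒length≤ : ∀ {xs ys : List A} → Unique xs → xs ⊆ ys → length xs ≤ length ys
unique-⊆⇒length≤ {xs = []} _ _ = z≤n
unique-⊆⇒length≤ {xs = x ∷ xs} {ys} (x≢xs ∷ unique) xs⊆ys with ∈⇒∃-removal (xs⊆ys (here refl))
... | zs , len , keep = begin
  suc (length xs) ≤⟨ s≤s (unique-⊆⇒length≤ unique xs⊆zs) ⟩
  suc (length zs) ≡⟨ sym len ⟩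
  length ys       ∎
  where
  open ≤-Reasoning
  xs⊆zs : xs ⊆ zs
  xs⊆zs y∈xs = keep (xs⊆ys (there y∈xs)) (All.lookup x≢xs y∈xs)

module _ (_≟_ : DecidableEquality A) where

  open DecMembership _≟_ using (_∈?_)

  unique-length>⇒∃∉ : ∀ {xs ys : List A} → Unique xs → length ys < length xs → ∃[ x ] x ∈ xs × x ∉ ys
  unique-length>⇒∃∉ {xs} {ys} unique longer with all? (_∈? ys) xs
  ... | yes xs⊆ys = contradiction (unique-⊆⇒length≤ unique (All.lookup xs⊆ys)) (<⇒≱ longer)
  ... | no xs⊈ys  = find (¬All⇒Any¬ (_∈? ys) xs xs⊈ys)

  unique-2≤length⇒∃≢ : ∀ {xs : List A} → Unique xs → 2 ≤ length xs → ∀ y → ∃[ x ] x ∈ xs × x ≢ y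
  unique-2≤length⇒∃≢ {x ∷ x′ ∷ _} ((x≢x′ ∷ _) ∷ _) (s≤s (s≤s _)) y with x ≟ y
  ... | yes refl = x′ , there (here refl) , x≢x′ ∘ sym
  ... | no x≢y   = x , here refl , x≢y

+-suc-cong : ∀ {i j k l} → i + j ≡ k + l → i + suc j ≡ k + suc l
+-suc-cong {i} {j} {k} {l} eq = trans (+-suc i j) (trans (cong suc eq) (sym (+-suc k l)))

module _ {P Q : Pred A p} (P? : Decidable P) (Q? : Decidable Q) where

  length-filter-∩-∪ : ∀ xs → length (filter P? xs) + length (filter Q? xs)
                           ≡ length (filter (P? ∩? Q?) xs) + length (filter (P? ∪? Q?) xs)
  length-filter-∩-∪ [] = refl
  length-filter-∩-∪ (x ∷ xs) with ih ← length-filter-∩-∪ xs | P? x | Q? x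
  ... | yes _ | yes _ = cong suc (+-suc-cong ih)
  ... | yes _ | no _  = trans (cong suc ih) (sym (+-suc _ _))
  ... | no _  | yes _ = +-suc-cong ih
  ... | no _  | no _  = ih

  length-filter-mono : (∀ {x} → P x → Q x) → ∀ xs → length (filter P? xs) ≤ length (filter Q? xs)
  length-filter-mono P⇒Q xs =
    Sublist.length-mono-≤ (Sublist.filter⁺ P? Q? (λ { refl → P⇒Q }) (Sublist.⊆-refl {x = xs}))

m≤2*x⇒m≤2*y⇒m≤x+y : ∀ {m x y} → m ≤ 2 * x → m ≤ 2 * y → m ≤ x + y
m≤2*x⇒m≤2*y⇒m≤x+y {m} {x} {y} m≤2x m≤2y = *-cancelˡ-≤ 2 (begin
  2 * m         ≡⟨ cong (m +_) (+-identityʳ m) ⟩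
  m + m         ≤⟨ +-mono-≤ m≤2x m≤2y ⟩
  2 * x + 2 * y ≡⟨ sym (*-distribˡ-+ 2 x y) ⟩
  2 * (x + y)   ∎)
  where open ≤-Reasoning

module Bipartite {n : ℕ} (G : SimpleGraph n) (part : Fin n → Bool) (bipartite : IsBipartition G part) where

  X₁? : Decidable (λ v → part v ≡ true)
  X₁? v = part v ≟ᵇ true

  X₂? : Decidable (λ v → part v ≡ false)
  X₂? v = part v ≟ᵇ false

  X₂ : List (Fin n)
  X₂ = filter X₂? (allFin n)

  all-X₂ : All (λ v → part v ≡ false) X₂
  all-X₂ = All.tabulate (proj₂ ∘ ∈-filter⁻ X₂? {xs = allFin n})

  X₁≢X₂ : ∀ {u v} → part u ≡ true → part v ≡ false → u ≢ v
  X₁≢X₂ pu pv refl = case trans (sym pu) pv of λ ()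

  adj-sym : ∀ {u v} → Adj G u v → Adj G v u
  adj-sym {u} {v} = subst T (symmetric G u v)

  adj⇒part-not : ∀ {u v} → Adj G u v → part v ≡ not (part u)
  adj⇒part-not {u} {v} uv = ¬-not (bipartite u v uv ∘ sym)

  adj-X₂⇒X₁ : ∀ {u v} → Adj G u v → part u ≡ false → part v ≡ true
  adj-X₂⇒X₁ uv pu = trans (adj⇒part-not uv) (cong not pu)

  adj-X₁⇒X₂ : ∀ {u v} → Adj G u v → part u ≡ true → part v ≡ false
  adj-X₁⇒X₂ uv pu = trans (adj⇒part-not uv) (cong not pu)

  partSize-true+false≤n : partSize part true + partSize part false ≤ n
  partSize-true+false≤n = begin
    partSize part true + partSize part false
      ≡⟨ length-filter-∩-∪ X₁? X₂? (allFin n) ⟩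
    length (filter (X₁? ∩? X₂?) (allFin n)) + length (filter (X₁? ∪? X₂?) (allFin n))
      ≡⟨ cong (λ xs → length xs + length (filter (X₁? ∪? X₂?) (allFin n)))
              (filter-none (X₁? ∩? X₂?) (All.universal disjoint (allFin n))) ⟩
    length (filter (X₁? ∪? X₂?) (allFin n))
      ≤⟨ length-filter (X₁? ∪? X₂?) (allFin n) ⟩
    length (allFin n)
      ≡⟨ length-tabulate id ⟩
    n ∎
    where
    open ≤-Reasoning
    disjoint : ∀ v → ¬ (part v ≡ true × part v ≡ false)
    disjoint v (pv , pv′) = X₁≢X₂ pv pv′ refl

  length-filter-X₂≤partSize : ∀ {vs} → Unique vs → length (filter X₂? vs) ≤ partSize part false
  length-filter-X₂≤partSize {vs} unique = unique-⊆⇒length≤ (Unique.filter⁺ X₂? unique) λ v∈vs₂ →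
    ∈-filter⁺ X₂? (∈-allFin _) (proj₂ (∈-filter⁻ X₂? {xs = vs} v∈vs₂))

  Balanced : List (Fin n) → Set
  Balanced vs = length (filter X₁? vs) < length (filter X₂? vs)

  balanced-[-] : ∀ {v} → part v ≡ false → Balanced (v ∷ [])
  balanced-[-] pv rewrite pv = s≤s z≤n

  balanced-∷-∷ : ∀ {z w vs} → part z ≡ false → part w ≡ true → Balanced vs → Balanced (z ∷ w ∷ vs)
  balanced-∷-∷ pz pw balanced rewrite pz | pw = s≤s balanced

  neighbour? : (v : Fin n) → Decidable (Adj G v)
  neighbour? v u = T? (adj G v u)

  commonNeighbours : Fin n → Fin n → List (Fin n)
  commonNeighbours u v = filter (neighbour? u ∩? neighbour? v) (allFin n)

  degree+degree≤commonNeighbours+partSize : ∀ {u v} → part u ≡ false → part v ≡ false →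
    degree G u + degree G v ≤ length (commonNeighbours u v) + partSize part true
  degree+degree≤commonNeighbours+partSize {u} {v} pu pv = begin
    degree G u + degree G v
      ≡⟨ length-filter-∩-∪ (neighbour? u) (neighbour? v) (allFin n) ⟩
    length (commonNeighbours u v) + length (filter (neighbour? u ∪? neighbour? v) (allFin n))
      ≤⟨ +-monoʳ-≤ _ (length-filter-mono _ X₁? neighbour-in-X₁ (allFin n)) ⟩
    length (commonNeighbours u v) + partSize part true ∎
    where
    open ≤-Reasoning
    neighbour-in-X₁ : ∀ {w} → Adj G u w ⊎ Adj G v w → part w ≡ true
    neighbour-in-X₁ (inj₁ uw) = adj-X₂⇒X₁ uw pu
    neighbour-in-X₁ (inj₂ vw) = adj-X₂⇒X₁ vw pv

  module Dense (dense : ∀ v → part v ≡ false → suc n ≤ 2 * degree G v) where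

    partSize<commonNeighbours : ∀ {u v} → part u ≡ false → part v ≡ false →
      partSize part false < length (commonNeighbours u v)
    partSize<commonNeighbours {u} {v} pu pv = +-cancelʳ-≤ (partSize part true) _ _ (begin
      suc (partSize part false) + partSize part true
        ≡⟨ cong suc (+-comm (partSize part false) _) ⟩
      suc (partSize part true + partSize part false)
        ≤⟨ s≤s partSize-true+false≤n ⟩
      suc n
        ≤⟨ m≤2*x⇒m≤2*y⇒m≤x+y {x = degree G u} {degree G v} (dense u pu) (dense v pv) ⟩
      degree G u + degree G v
        ≤⟨ degree+degree≤commonNeighbours+partSize pu pv ⟩
      length (commonNeighbours u v) + partSize part true ∎)
      where open ≤-Reasoning

    ∃-commonNeighbour-∉ : ∀ {u v} → part u ≡ false → part v ≡ false → (U : List (Fin n)) →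
      length (filter X₁? U) ≤ partSize part false → ∃[ w ] Adj G u w × Adj G v w × w ∉ U
    ∃-commonNeighbour-∉ pu pv U budget
      with w , w∈common , w∉U₁ ← unique-length>⇒∃∉ _≟ᶠ_
             (Unique.filter⁺ _ (Unique.allFin⁺ n)) (≤-<-trans budget (partSize<commonNeighbours pu pv))
      with uw , vw ← proj₂ (∈-filter⁻ (neighbour? _ ∩? neighbour? _) {xs = allFin n} w∈common)
      = w , uw , vw , λ w∈U → w∉U₁ (∈-filter⁺ X₁? w∈U (adj-X₂⇒X₁ uw pu))

    module Greedy {x₁ y₁ x₂ : Fin n} (x₁∈X₁ : part x₁ ≡ true) (y₁∈X₂ : part y₁ ≡ false) where

      open DecMembership (_≟ᶠ_ {n}) using (_∈?_)

      record Tail : Set where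
        field
          first    : Fin n
          rest     : List (Fin n)
          first∈X₂ : part first ≡ false
          unique   : Unique (first ∷ rest)
          linked   : Linked (Adj G) (first ∷ rest)
          last≡x₂  : last (first ∷ rest) ≡ just x₂
          x₁-fresh : All (x₁ ≢_) (first ∷ rest)
          y₁-fresh : All (y₁ ≢_) (first ∷ rest)
          balanced : Balanced (first ∷ rest)

      route : Tail → List (Fin n)
      route T = Tail.first T ∷ Tail.rest T

      start : y₁ ≢ x₂ → part x₂ ≡ false → Tail
      start y₁≢x₂ x₂∈X₂ = record
        { first    = x₂
        ; rest     = []
        ; first∈X₂ = x₂∈X₂
        ; unique   = [] ∷ []
        ; linked   = [-]
        ; last≡x₂  = refl
        ; x₁-fresh = X₁≢X₂ x₁∈X₁ x₂∈X₂ ∷ []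
        ; y₁-fresh = y₁≢x₂ ∷ []
        ; balanced = balanced-[-] x₂∈X₂
        }

      x₁∷route-budget : (T : Tail) → length (filter X₁? (x₁ ∷ route T)) ≤ partSize part false
      x₁∷route-budget T = begin
        length (filter X₁? (x₁ ∷ route T))  ≡⟨ cong length (filter-accept X₁? x₁∈X₁) ⟩
        suc (length (filter X₁? (route T))) ≤⟨ balanced ⟩
        length (filter X₂? (route T))       ≤⟨ length-filter-X₂≤partSize unique ⟩
        partSize part false                 ∎
        where
        open ≤-Reasoning
        open Tail T

      ∃-fresh-link : (T : Tail) → ∀ {z} → part z ≡ false →
        ∃[ w ] Adj G z w × Adj G (Tail.first T) w × w ∉ x₁ ∷ route T
      ∃-fresh-link T z∈X₂ = ∃-commonNeighbour-∉ z∈X₂ (Tail.first∈X₂ T) (x₁ ∷ route T) (x₁∷route-budget T)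

      extend : (T : Tail) → ∀ {z} → part z ≡ false → All (z ≢_) (route T) → z ≢ y₁ → Tail
      extend T {z} z∈X₂ z-fresh z≢y₁ with w , zw , w-first , w∉ ← ∃-fresh-link T z∈X₂ = record
        { first    = z
        ; rest     = w ∷ route T
        ; first∈X₂ = z∈X₂
        ; unique   = (X₁≢X₂ w∈X₁ z∈X₂ ∘ sym ∷ z-fresh) ∷ ¬Any⇒All¬ _ (w∉ ∘ there) ∷ unique
        ; linked   = zw ∷ adj-sym w-first ∷ linked
        ; last≡x₂  = last≡x₂
        ; x₁-fresh = X₁≢X₂ x₁∈X₁ z∈X₂ ∷ w∉ ∘ here ∘ sym ∷ x₁-fresh
        ; y₁-fresh = z≢y₁ ∘ sym ∷ X₁≢X₂ w∈X₁ y₁∈X₂ ∘ sym ∷ y₁-fresh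
        ; balanced = balanced-∷-∷ z∈X₂ w∈X₁ balanced
        }
        where
        open Tail T
        w∈X₁ : part w ≡ true
        w∈X₁ = adj-X₂⇒X₁ zw z∈X₂

      Covers : Tail → List (Fin n) → Set
      Covers T R = All (λ r → r ∈ route T ⊎ r ≡ y₁) R

      cover : ∀ R → All (λ r → part r ≡ false) R → Tail → Σ Tail λ T → Covers T R
      cover []      []                T = T , []
      cover (r ∷ R) (r∈X₂ ∷ R⊆X₂) T with T′ , T′-covers ← cover R R⊆X₂ T with r ≟ᶠ y₁ | r ∈? route T′
      ... | yes r≡y₁ | _        = T′ , inj₂ r≡y₁ ∷ T′-covers
      ... | no _     | yes r∈T′ = T′ , inj₁ r∈T′ ∷ T′-covers
      ... | no r≢y₁  | no r∉T′  = extend T′ r∈X₂ (¬Any⇒All¬ _ r∉T′) r≢y₁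
                                , inj₁ (here refl) ∷ All.map (Sum.map₁ (there ∘ there)) T′-covers

      close : Adj G x₁ y₁ → (T : Tail) → Covers T X₂ →
        Σ (Path G x₁ x₂) λ P → ∀ v → part v ≡ false → v ∈ vertices P
      close x₁y₁ T covers with w , y₁w , w-first , w∉ ← ∃-fresh-link T y₁∈X₂ = path , covers-X₂
        where
        open Tail T
        w∈X₁ : part w ≡ true
        w∈X₁ = adj-X₂⇒X₁ y₁w y₁∈X₂

        path : Path G x₁ x₂
        path = record
          { vertices = x₁ ∷ y₁ ∷ w ∷ route T
          ; distinct = (X₁≢X₂ x₁∈X₁ y₁∈X₂ ∷ w∉ ∘ here ∘ sym ∷ x₁-fresh)
                     ∷ (X₁≢X₂ w∈X₁ y₁∈X₂ ∘ sym ∷ y₁-fresh)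
                     ∷ ¬Any⇒All¬ _ (w∉ ∘ there)
                     ∷ unique
          ; walk     = x₁y₁ ∷ y₁w ∷ adj-sym w-first ∷ linked
          ; starts   = refl
          ; ends     = last≡x₂
          }

        covers-X₂ : ∀ v → part v ≡ false → v ∈ x₁ ∷ y₁ ∷ w ∷ route T
        covers-X₂ v v∈X₂ with All.lookup covers (∈-filter⁺ X₂? (∈-allFin v) v∈X₂)
        ... | inj₁ v∈T  = there (there (there v∈T))
        ... | inj₂ refl = there (here refl)

corollary6p7 : (n : ℕ) → 5 ≤ n → (G : SimpleGraph n) → (part : Fin n → Bool)
    → IsBipartition G part
    → partSize part false < partSize part true
    → (∀ v → part v ≡ false → suc n ≤ 2 * degree G v)
    → (x₁ x₂ : Fin n) → part x₁ ≡ true → part x₂ ≡ false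
    → 2 ≤ degree G x₁ → 2 ≤ degree G x₂
    → Σ (Path G x₁ x₂) (λ P → ∀ v → part v ≡ false → v ∈ vertices P)
corollary6p7 n _ G part bipartite _ dense x₁ x₂ x₁∈X₁ x₂∈X₂ 2≤d[x₁] _
  with y₁ , y₁∈N[x₁] , y₁≢x₂ ← unique-2≤length⇒∃≢ _≟ᶠ_ (Unique.filter⁺ _ (Unique.allFin⁺ n)) 2≤d[x₁] x₂
  with x₁y₁ ← proj₂ (∈-filter⁻ (T? ∘ adj G x₁) {xs = allFin n} y₁∈N[x₁])
  = uncurry (close x₁y₁) (cover X₂ all-X₂ (start y₁≢x₂ x₂∈X₂))
  where
  open Bipartite G part bipartite
  open Dense dense
  open Greedy x₁∈X₁ (adj-X₁⇒X₂ x₁y₁ x₁∈X₁)
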